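{- Let $k\in2\mathbb{Z}^+$, let $p$ be a rational prime and let $g=\sum_{m\gg-\infty}a_m(g)q^m$ be a Laurent series with all $a_m(g)\in\overline{\mathbb{Z}_p}$. For $n\in\mathbb{Z}^+$ let $g_n:=n^{k-1}\,g|T_{n,2-k}$. Then for all $n\in\mathbb{Z}^+$, $g_{np}\equiv g_n|V_p\pmod{p^{k-1}}$ as $q$-series.
   Context: For a Laurent series $f=\sum_{n\gg-\infty}a_n(f)q^n$, $k'\in\mathbb{Z}$ and $m\in\mathbb{Z}^+$: $a_n(f|T_{m,k'}):=\sum_{r>0,\ r\mid m,\ r\mid n}r^{k'-1}a_{mn/r^2}(f)$ for all $n\in\mathbb{Z}$; and $f|V_p:=\sum_n a_n(f)q^{np}$. A congruence of $q$-series modulo $p^{e}$ means coefficientwise congruence in $\overline{\mathbb{Z}_p}$. -}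

module Defs where

open import Level using (_⊔_)
open import Algebra.Bundles using (CommutativeRing)
open import Data.Nat as ℕ using (ℕ; zero; suc; NonZero)
open import Data.Nat.Divisibility using (_∣?_)
open import Data.Nat.DivMod using () renaming (_/_ to _/ⁿ_)
open import Data.Integer as ℤ using (ℤ; +_; ∣_∣)
open import Data.Integer.DivMod using (_/ℕ_)
open import Data.List using (List; foldr; map; upTo)
open import Data.Product using (∃)
open import Relation.Nullary using (yes; no)

-- Coefficients of q-series (Laurent series) over a commutative ring R
-- are modelled as functions ℤ → Carrier R.
module Laurent {c ℓ} (R : CommutativeRing c ℓ) where
  open CommutativeRing R

  ι : ℕ → Carrier
  ι zero    = 0#
  ι (suc n) = 1# + ι n

  ΣL : List Carrier → Carrier
  ΣL = foldr _+_ 0#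

  IsLaurent : (ℤ → Carrier) → Set ℓ
  IsLaurent f = ∃ λ (N : ℤ) → ∀ (m : ℤ) → m ℤ.< N → f m ≈ 0#

  -- a_m(g_n) where g_n := n^(k-1) · g|T_{n,2-k}.
  -- Since n^(k-1) · r^((2-k)-1) = (n/r)^(k-1) for r ∣ n, this is
  --   a_m(g_n) = Σ_{r>0, r∣n, r∣m} (n/r)^(k-1) a_{nm/r²}(g).
  -- r ranges over 1..n (r = suc i, i < n); nm/r² is computed as exact
  -- integer division.
  gcoef : (k : ℕ) → (ℤ → Carrier) → ℕ → ℤ → Carrier
  gcoef k g n m = ΣL (map term (upTo n))
    where
    term : ℕ → Carrier
    term i with suc i ∣? n | suc i ∣? ∣ m ∣
    ... | yes _ | yes _ =
          ι ((n /ⁿ suc i) ℕ.^ (k ℕ.∸ 1)) * g ((m ℤ.* + n) /ℕ (suc i ℕ.* suc i))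
    ... | _     | _     = 0#

  V : (p : ℕ) → .{{NonZero p}} → (ℤ → Carrier) → ℤ → Carrier
  V p f j with p ∣? ∣ j ∣
  ... | yes _ = f (j /ℕ p)
  ... | no  _ = 0#

  _≡_[mod_] : (ℤ → Carrier) → (ℤ → Carrier) → ℕ → Set (c ⊔ ℓ)
  f ≡ h [mod M ] = ∀ (j : ℤ) → ∃ λ (x : Carrier) → f j - h j ≈ ι M * x

{-# OPTIONS --safe #-}
-- In a_j(g_{np}) = Σ_{r ∣ np, r ∣ j} (np/r)^(k-1) a_{npj/r²}(g), Euclid's lemma shows that p divides
-- np/r whenever p ∤ r, so those summands vanish modulo p^(k-1). The remaining divisors are r = sp,
-- and their summands are exactly those of a_{j/p}(g_n) if p ∣ j, and zero otherwise: together they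
-- form a_j(g_n|V_p). To separate the two kinds, cut the range 1 ≤ r ≤ np into n blocks of p
-- consecutive integers; the last element of each block is its only multiple of p.
module Submission where

open import Defs
open import Level using (_⊔_)
open import Algebra.Bundles using (CommutativeMonoid; CommutativeRing)
import Algebra.Properties.CommutativeSemigroup as CommutativeSemigroupProperties
open import Data.Nat as ℕ using (ℕ; zero; suc; NonZero; _<_; _∸_; z<s; s<s)
import Data.Nat.Properties as ℕP
open import Data.Nat.Divisibility
  using (_∣_; _∤_; divides; _∣?_; ∣-refl; ∣-trans; n∣m*n; *-pres-∣; *-monoˡ-∣; *-cancelʳ-∣;
         ∣m+n∣m⇒∣n; >⇒∤; n/m≡quotient)
open import Data.Nat.DivMod using (/-congʳ; m*n/o*n≡m/o)
open import Data.Nat.Primality using (Prime; euclidsLemma)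
open import Data.Integer as ℤ using (ℤ; +_; -[1+_]; ∣_∣; _/ℕ_)
import Data.Integer.Properties as ℤP
import Relation.Binary.Reasoning.Setoid
open import Data.Integer.Divisibility.Signed using (∣ᵤ⇒∣)
import Data.Integer.Divisibility.Signed as Signed
open import Data.List using (foldr; applyUpTo)
open import Data.List.Properties using (map-applyUpTo)
open import Data.Product using (_×_; _,_)
open import Data.Sum using (inj₁; inj₂)
open import Function using (id; _∘_; it)
open import Relation.Nullary using (¬_; yes; no; contradiction)
open import Relation.Nullary.Decidable using (_×-dec_)
open import Relation.Binary.PropositionalEquality as ≡ using (_≡_)

module NatArithmetic where
  open ≡ using (sym; subst)
  open import Data.Nat using (_+_; _*_; _^_)
  open import Data.Nat.DivMod using (_/_)

  ^-mono-∣ : ∀ {m n} e → m ∣ n → m ^ e ∣ n ^ e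
  ^-mono-∣ zero    _   = ∣-refl
  ^-mono-∣ (suc e) m∣n = *-pres-∣ m∣n (^-mono-∣ e m∣n)

  p∤d⇒p∣[n*p]/d : ∀ {p d} n .{{_ : NonZero d}} → Prime p → d ∣ n * p → p ∤ d → p ∣ (n * p) / d
  p∤d⇒p∣[n*p]/d {p} {d} n pp d∣n*p@(divides q n*p≡q*d) p∤d
    with euclidsLemma q d pp (subst (p ∣_) n*p≡q*d (n∣m*n n))
  ... | inj₁ p∣q = subst (p ∣_) (sym (n/m≡quotient d∣n*p)) p∣q
  ... | inj₂ p∣d = contradiction p∣d p∤d

  p∤t*p+r : ∀ {p} t {r} .{{_ : NonZero r}} → r < p → p ∤ t * p + r
  p∤t*p+r t r<p p∣t*p+r = >⇒∤ r<p (∣m+n∣m⇒∣n p∣t*p+r (n∣m*n t))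

  1+[t*p+p-1]≡[1+t]*p : ∀ t p' → suc (t * suc p' + p') ≡ suc t * suc p'
  1+[t*p+p-1]≡[1+t]*p t p' = ≡.cong suc (ℕP.+-comm (t * suc p') p')

open NatArithmetic

module IntegerDivision where
  open ≡ using (refl; sym; trans; cong; subst; module ≡-Reasoning)
  open import Data.Integer using (_*_)
  open import Data.Nat.DivMod using (m*n%n≡0; m*n/n≡m)

  [i*d]/ℕd≡i : ∀ i d .{{_ : NonZero d}} → (i * + d) /ℕ d ≡ i
  [i*d]/ℕd≡i (+ a)    d@(suc _) = trans (cong (_/ℕ d) (sym (ℤP.pos-* a d))) (cong +_ (m*n/n≡m a d))
  [i*d]/ℕd≡i -[1+ a ] d@(suc _)
    rewrite m*n%n≡0 (suc a) d {{ℕ.nonZero}} | m*n/n≡m (suc a) d {{ℕ.nonZero}} = refl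

  [i/ℕd]*d≡i : ∀ {i} d .{{_ : NonZero d}} → d ∣ ∣ i ∣ → (i /ℕ d) * + d ≡ i
  [i/ℕd]*d≡i {i} d d∣i with ∣ᵤ⇒∣ {+ d} {i} d∣i
  ... | Signed.divides q refl = cong (_* + d) ([i*d]/ℕd≡i q d)

  [i*c]/ℕ[d*c]≡i/ℕd : ∀ i c d .{{_ : NonZero d}} .{{_ : NonZero (d ℕ.* c)}} →
                      d ∣ ∣ i ∣ → (i * + c) /ℕ (d ℕ.* c) ≡ i /ℕ d
  [i*c]/ℕ[d*c]≡i/ℕd i c d d∣i with ∣ᵤ⇒∣ {+ d} {i} d∣i
  ... | Signed.divides q refl = begin
    (q * + d * + c) /ℕ (d ℕ.* c)    ≡⟨ cong (_/ℕ (d ℕ.* c)) (ℤP.*-assoc q (+ d) (+ c)) ⟩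
    (q * (+ d * + c)) /ℕ (d ℕ.* c)  ≡⟨ cong (λ x → (q * x) /ℕ (d ℕ.* c)) (ℤP.pos-* d c) ⟨
    (q * + (d ℕ.* c)) /ℕ (d ℕ.* c)  ≡⟨ [i*d]/ℕd≡i q (d ℕ.* c) ⟩
    q                               ≡⟨ [i*d]/ℕd≡i q d ⟨
    (q * + d) /ℕ d                  ∎
    where open ≡-Reasoning

  /ℕ-cong : ∀ {i j d e} .{{_ : NonZero d}} .{{_ : NonZero e}} → i ≡ j → d ≡ e → i /ℕ d ≡ j /ℕ e
  /ℕ-cong refl refl = refl

  [m*p*[n*p]]/ℕ[s*p]²≡[m*n]/ℕs² : ∀ m {n p s r}
    .{{_ : NonZero p}} .{{_ : NonZero (s ℕ.* s)}} .{{_ : NonZero (r ℕ.* r)}} →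
    r ≡ s ℕ.* p → s ∣ n → s ∣ ∣ m ∣ → (m * + p * + (n ℕ.* p)) /ℕ (r ℕ.* r) ≡ (m * + n) /ℕ (s ℕ.* s)
  [m*p*[n*p]]/ℕ[s*p]²≡[m*n]/ℕs² m {n} {p} {s} refl s∣n s∣m = begin
    (m * + p * + (n ℕ.* p)) /ℕ (s ℕ.* p ℕ.* (s ℕ.* p))   ≡⟨ /ℕ-cong numerator (ℕ*.interchange s p s p) ⟩
    (m * + n * + (p ℕ.* p)) /ℕ (s ℕ.* s ℕ.* (p ℕ.* p))   ≡⟨ [i*c]/ℕ[d*c]≡i/ℕd (m * + n) (p ℕ.* p) (s ℕ.* s) s*s∣m*n ⟩
    (m * + n) /ℕ (s ℕ.* s)                              ∎
    where
    open ≡-Reasoning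
    module ℕ* = CommutativeSemigroupProperties ℕP.*-commutativeSemigroup
    module ℤ* = CommutativeSemigroupProperties ℤP.*-commutativeSemigroup
    instance
      s*s*[p*p]≢0 : NonZero (s ℕ.* s ℕ.* (p ℕ.* p))
      s*s*[p*p]≢0 = ℕP.m*n≢0 (s ℕ.* s) (p ℕ.* p) {{it}} {{ℕP.m*n≢0 p p}}
    numerator : m * + p * + (n ℕ.* p) ≡ m * + n * + (p ℕ.* p)
    numerator = begin
      m * + p * + (n ℕ.* p)     ≡⟨ cong (m * + p *_) (ℤP.pos-* n p) ⟩
      m * + p * (+ n * + p)     ≡⟨ ℤ*.interchange m (+ p) (+ n) (+ p) ⟩
      m * + n * (+ p * + p)     ≡⟨ cong (m * + n *_) (ℤP.pos-* p p) ⟨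
      m * + n * + (p ℕ.* p)     ∎
    s*s∣m*n : s ℕ.* s ∣ ∣ m * + n ∣
    s*s∣m*n = subst (s ℕ.* s ∣_) (sym (ℤP.abs-* m (+ n))) (*-pres-∣ s∣m s∣n)

open IntegerDivision

module RangeSum {a ℓ} (M : CommutativeMonoid a ℓ) where
  open CommutativeMonoid M renaming (Carrier to A)
  open CommutativeSemigroupProperties commutativeSemigroup using (interchange)
  open import Data.Nat using (_+_; _*_)
  open import Relation.Binary.Reasoning.Setoid setoid

  sumUpTo : (ℕ → A) → ℕ → A
  sumUpTo f n = foldr _∙_ ε (applyUpTo f n)

  sumUpTo-cong : ∀ {f g} n → (∀ i → f i ≈ g i) → sumUpTo f n ≈ sumUpTo g n
  sumUpTo-cong zero    f≈g = refl
  sumUpTo-cong (suc n) f≈g = ∙-cong (f≈g 0) (sumUpTo-cong n (f≈g ∘ suc))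

  sumUpTo-ε : ∀ n → sumUpTo (λ _ → ε) n ≈ ε
  sumUpTo-ε zero    = refl
  sumUpTo-ε (suc n) = trans (identityˡ _) (sumUpTo-ε n)

  sumUpTo-distrib-∙ : ∀ f g n → sumUpTo (λ i → f i ∙ g i) n ≈ sumUpTo f n ∙ sumUpTo g n
  sumUpTo-distrib-∙ f g zero    = sym (identityˡ ε)
  sumUpTo-distrib-∙ f g (suc n) =
    trans (∙-congˡ (sumUpTo-distrib-∙ (f ∘ suc) (g ∘ suc) n)) (interchange _ _ _ _)

  sumUpTo-init-last : ∀ f n → sumUpTo f (suc n) ≈ sumUpTo f n ∙ f n
  sumUpTo-init-last f zero    = trans (identityʳ _) (sym (identityˡ _))
  sumUpTo-init-last f (suc n) = trans (∙-congˡ (sumUpTo-init-last (f ∘ suc) n)) (sym (assoc _ _ _))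

  sumUpTo-+ : ∀ f m n → sumUpTo f (m + n) ≈ sumUpTo f m ∙ sumUpTo (λ i → f (m + i)) n
  sumUpTo-+ f zero    n = sym (identityˡ _)
  sumUpTo-+ f (suc m) n = trans (∙-congˡ (sumUpTo-+ (f ∘ suc) m n)) (sym (assoc _ _ _))

  sumUpTo-* : ∀ f m n → sumUpTo f (m * n) ≈ sumUpTo (λ t → sumUpTo (λ i → f (t * n + i)) n) m
  sumUpTo-* f zero    n = refl
  sumUpTo-* f (suc m) n = begin
    sumUpTo f (n + m * n)
      ≈⟨ sumUpTo-+ f n (m * n) ⟩
    sumUpTo f n ∙ sumUpTo (λ i → f (n + i)) (m * n)
      ≈⟨ ∙-congˡ (sumUpTo-* (λ i → f (n + i)) m n) ⟩
    sumUpTo f n ∙ sumUpTo (λ t → sumUpTo (λ i → f (n + (t * n + i))) n) m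
      ≈⟨ ∙-congˡ (sumUpTo-cong m λ t → sumUpTo-cong n λ i → reflexive (≡.cong f (≡.sym (ℕP.+-assoc n (t * n) i)))) ⟩
    sumUpTo f n ∙ sumUpTo (λ t → sumUpTo (λ i → f (suc t * n + i)) n) m
      ∎

module _ {c ℓ} (R : CommutativeRing c ℓ) where
  open CommutativeRing R hiding (zero)
  open Laurent R
  open RangeSum +-commutativeMonoid
  module ≈-Reasoning = Relation.Binary.Reasoning.Setoid setoid

  ι-homo-* : ∀ m n → ι (m ℕ.* n) ≈ ι m * ι n
  ι-homo-* m n = begin
    ι (m ℕ.* n)           ≈⟨ ι≈×1# (m ℕ.* n) ⟩
    (m ℕ.* n) · 1#        ≈⟨ ×1-homo-* m n ⟩
    (m · 1#) * (n · 1#)   ≈⟨ *-cong (ι≈×1# m) (ι≈×1# n) ⟨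
    ι m * ι n             ∎
    where
    open ≈-Reasoning
    open import Algebra.Properties.Semiring.Mult semiring using (×1-homo-*) renaming (_×_ to _·_)
    ι≈×1# : ∀ n → ι n ≈ n · 1#
    ι≈×1# zero    = refl
    ι≈×1# (suc n) = +-congˡ (ι≈×1# n)

  infix 4 _∣ᴿ_
  record _∣ᴿ_ (M : ℕ) (x : Carrier) : Set (c ⊔ ℓ) where
    constructor multiple
    field
      quotient : Carrier
      equality : x ≈ ι M * quotient

  ∣ᴿ-respʳ-≈ : ∀ {M x y} → x ≈ y → M ∣ᴿ x → M ∣ᴿ y
  ∣ᴿ-respʳ-≈ x≈y (multiple z x≈Mz) = multiple z (trans (sym x≈y) x≈Mz)

  ∣ᴿ-0# : ∀ {M} → M ∣ᴿ 0#
  ∣ᴿ-0# = multiple 0# (sym (zeroʳ _))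

  ∣ᴿ-+ : ∀ {M x y} → M ∣ᴿ x → M ∣ᴿ y → M ∣ᴿ x + y
  ∣ᴿ-+ (multiple z x≈Mz) (multiple w y≈Mw) =
    multiple (z + w) (trans (+-cong x≈Mz y≈Mw) (sym (distribˡ _ z w)))

  ∣ᴿ-sumUpTo : ∀ {M f} n → (∀ i → i < n → M ∣ᴿ f i) → M ∣ᴿ sumUpTo f n
  ∣ᴿ-sumUpTo zero    _   = ∣ᴿ-0#
  ∣ᴿ-sumUpTo (suc n) M∣f = ∣ᴿ-+ (M∣f 0 z<s) (∣ᴿ-sumUpTo n λ i i<n → M∣f (suc i) (s<s i<n))

  ∣⇒∣ᴿ-ι* : ∀ {M a} x → M ∣ a → M ∣ᴿ ι a * x
  ∣⇒∣ᴿ-ι* {M} x (divides q ≡.refl) = multiple (ι q * x) (begin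
    ι (q ℕ.* M) * x       ≈⟨ *-congʳ (ι-homo-* q M) ⟩
    ι q * ι M * x         ≈⟨ *-congʳ (*-comm (ι q) (ι M)) ⟩
    ι M * ι q * x         ≈⟨ *-assoc (ι M) (ι q) x ⟩
    ι M * (ι q * x)       ∎)
    where open ≈-Reasoning

  ∣ᴿ-−-cancelʳ : ∀ {M x y z} → M ∣ᴿ z → x ≈ z + y → M ∣ᴿ x - y
  ∣ᴿ-−-cancelʳ {x = x} {y} {z} M∣z x≈z+y = ∣ᴿ-respʳ-≈ (sym (begin
    x - y           ≈⟨ +-congʳ x≈z+y ⟩
    z + y - y       ≈⟨ +-assoc z y (- y) ⟩
    z + (y - y)     ≈⟨ +-congˡ (-‿inverseʳ y) ⟩
    z + 0#          ≈⟨ +-identityʳ z ⟩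
    z               ∎)) M∣z
    where open ≈-Reasoning

  module _ (k : ℕ) (g : ℤ → Carrier) (n : ℕ) (m : ℤ) where
    open import Data.Nat.DivMod using (_/_)

    -- Defs keeps the summand of gcoef local to a where block; the body `_` below is solved by
    -- unification with the proof of gcoef≡sumUpTo-summand, which is how the summand gets a name.
    mutual
      summand : ℕ → Carrier
      summand = _

      gcoef≡sumUpTo-summand : gcoef k g n m ≡ sumUpTo summand n
      gcoef≡sumUpTo-summand = ≡.cong (foldr _+_ 0#) (map-applyUpTo id _ n)

    summand-∣ : ∀ {i} → suc i ∣ n → suc i ∣ ∣ m ∣ →
                summand i ≡ ι ((n / suc i) ℕ.^ (k ∸ 1)) * g ((m ℤ.* + n) /ℕ (suc i ℕ.* suc i))
    summand-∣ {i} r∣n r∣m with suc i ∣? n | suc i ∣? ∣ m ∣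
    ... | yes _    | yes _    = ≡.refl
    ... | no  r∤n  | _        = contradiction r∣n r∤n
    ... | yes _    | no  r∤m  = contradiction r∣m r∤m

    summand-∤ : ∀ {i} → ¬ ((suc i ∣ n) × (suc i ∣ ∣ m ∣)) → summand i ≡ 0#
    summand-∤ {i} r∤n×m with suc i ∣? n | suc i ∣? ∣ m ∣
    ... | yes r∣n | yes r∣m = contradiction (r∣n , r∣m) r∤n×m
    ... | no  _   | _       = ≡.refl
    ... | yes _   | no  _   = ≡.refl

  p∤r⇒p^[k-1]∣ᴿsummand : ∀ k g n m {p i} → Prime p → p ∤ suc i →
                         p ℕ.^ (k ∸ 1) ∣ᴿ summand k g (n ℕ.* p) m i
  p∤r⇒p^[k-1]∣ᴿsummand k g n m {p} {i} pp p∤r with suc i ∣? n ℕ.* p ×-dec suc i ∣? ∣ m ∣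
  ... | yes (r∣n*p , r∣m) = ∣ᴿ-respʳ-≈ (reflexive (≡.sym (summand-∣ k g (n ℕ.* p) m r∣n*p r∣m)))
                              (∣⇒∣ᴿ-ι* _ (^-mono-∣ (k ∸ 1) (p∤d⇒p∣[n*p]/d n pp r∣n*p p∤r)))
  ... | no  r∤both        = ∣ᴿ-respʳ-≈ (reflexive (≡.sym (summand-∤ k g (n ℕ.* p) m r∤both))) ∣ᴿ-0#

  summand-rescale : ∀ k g n {p} .{{_ : NonZero p}} {m J i t} → m ≡ J ℤ.* + p → suc i ≡ suc t ℕ.* p →
                    summand k g (n ℕ.* p) m i ≡ summand k g n J t
  summand-rescale k g n {p} {J = J} {i} {t} ≡.refl r≡s*p with suc t ∣? n ×-dec suc t ∣? ∣ J ∣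
  ... | yes (s∣n , s∣J) = begin
    summand k g (n ℕ.* p) (J ℤ.* + p) i
      ≡⟨ summand-∣ k g (n ℕ.* p) (J ℤ.* + p) r∣n*p r∣J*p ⟩
    ι ((n ℕ.* p / suc i) ℕ.^ (k ∸ 1)) * g ((J ℤ.* + p ℤ.* + (n ℕ.* p)) /ℕ (suc i ℕ.* suc i))
      ≡⟨ ≡.cong₂ (λ a b → ι (a ℕ.^ (k ∸ 1)) * g b)
                 (≡.trans (/-congʳ r≡s*p) (m*n/o*n≡m/o n p (suc t)))
                 ([m*p*[n*p]]/ℕ[s*p]²≡[m*n]/ℕs² J r≡s*p s∣n s∣J) ⟩
    ι ((n / suc t) ℕ.^ (k ∸ 1)) * g ((J ℤ.* + n) /ℕ (suc t ℕ.* suc t))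
      ≡⟨ summand-∣ k g n J s∣n s∣J ⟨
    summand k g n J t
      ∎
    where
    open ≡.≡-Reasoning
    open import Data.Nat.DivMod using (_/_)
    instance _ = ℕP.m*n≢0 (suc t) p
    r∣n*p : suc i ∣ n ℕ.* p
    r∣n*p = ≡.subst (_∣ n ℕ.* p) (≡.sym r≡s*p) (*-monoˡ-∣ p s∣n)
    r∣J*p : suc i ∣ ∣ J ℤ.* + p ∣
    r∣J*p = ≡.subst₂ _∣_ (≡.sym r≡s*p) (≡.sym (ℤP.abs-* J (+ p))) (*-monoˡ-∣ p s∣J)
  ... | no  s∤both = ≡.trans (summand-∤ k g (n ℕ.* p) (J ℤ.* + p) (s∤both ∘ cancel))
                             (≡.sym (summand-∤ k g n J s∤both))
    where
    cancel : (suc i ∣ n ℕ.* p) × (suc i ∣ ∣ J ℤ.* + p ∣) → (suc t ∣ n) × (suc t ∣ ∣ J ∣)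
    cancel (r∣n*p , r∣J*p) =
      *-cancelʳ-∣ p (≡.subst (_∣ n ℕ.* p) r≡s*p r∣n*p) ,
      *-cancelʳ-∣ p (≡.subst₂ _∣_ r≡s*p (ℤP.abs-* J (+ p)) r∣J*p)

  summands-at-multiples-of-p≈V-gcoef : ∀ k g n {p'} j →
    sumUpTo (λ t → summand k g (n ℕ.* suc p') j (t ℕ.* suc p' ℕ.+ p')) n ≈ V (suc p') (gcoef k g n) j
  summands-at-multiples-of-p≈V-gcoef k g n {p'} j with suc p' ∣? ∣ j ∣
  ... | yes p∣j = begin
    sumUpTo (λ t → summand k g (n ℕ.* p) j (t ℕ.* p ℕ.+ p')) n
      ≈⟨ sumUpTo-cong n (λ t → reflexive (summand-rescale k g n j≡[j/p]*p (1+[t*p+p-1]≡[1+t]*p t p'))) ⟩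
    sumUpTo (summand k g n (j /ℕ p)) n
      ≡⟨ gcoef≡sumUpTo-summand k g n (j /ℕ p) ⟨
    gcoef k g n (j /ℕ p)
      ∎
    where
    open ≈-Reasoning
    p = suc p'
    j≡[j/p]*p : j ≡ (j /ℕ p) ℤ.* + p
    j≡[j/p]*p = ≡.sym ([i/ℕd]*d≡i p p∣j)
  ... | no  p∤j = trans (sumUpTo-cong n λ t → reflexive (summand-∤ k g (n ℕ.* p) j (p∤j ∘ p∣j t)))
                        (sumUpTo-ε n)
    where
    p = suc p'
    p∣j : ∀ t → (suc (t ℕ.* p ℕ.+ p') ∣ n ℕ.* p) × (suc (t ℕ.* p ℕ.+ p') ∣ ∣ j ∣) → p ∣ ∣ j ∣
    p∣j t (_ , r∣j) = ∣-trans (≡.subst (p ∣_) (≡.sym (1+[t*p+p-1]≡[1+t]*p t p')) (n∣m*n (suc t))) r∣j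

  ∣ᴿ-−⇒≡[mod] : ∀ {M} {f h : ℤ → Carrier} → (∀ j → M ∣ᴿ f j - h j) → f ≡ h [mod M ]
  ∣ᴿ-−⇒≡[mod] M∣f-h j = let multiple z f-h≈Mz = M∣f-h j in z , f-h≈Mz

  gcoef[n*p]≡V[gcoef[n]] : ∀ k g n {p'} → Prime (suc p') →
    gcoef k g (n ℕ.* suc p') ≡ V (suc p') (gcoef k g n) [mod suc p' ℕ.^ (k ∸ 1) ]
  gcoef[n*p]≡V[gcoef[n]] k g n {p'} pp = ∣ᴿ-−⇒≡[mod] λ j → ∣ᴿ-−-cancelʳ (off-multiples j) (begin
    gcoef k g (n ℕ.* p) j
      ≡⟨ gcoef≡sumUpTo-summand k g (n ℕ.* p) j ⟩
    sumUpTo (F j) (n ℕ.* p)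
      ≈⟨ sumUpTo-* (F j) n p ⟩
    sumUpTo (λ t → sumUpTo (λ i → F j (t ℕ.* p ℕ.+ i)) p) n
      ≈⟨ sumUpTo-cong n (λ t → sumUpTo-init-last (λ i → F j (t ℕ.* p ℕ.+ i)) p') ⟩
    sumUpTo (λ t → sumUpTo (λ i → F j (t ℕ.* p ℕ.+ i)) p' + F j (t ℕ.* p ℕ.+ p')) n
      ≈⟨ sumUpTo-distrib-∙ _ _ n ⟩
    sumUpTo (λ t → sumUpTo (λ i → F j (t ℕ.* p ℕ.+ i)) p') n + sumUpTo (λ t → F j (t ℕ.* p ℕ.+ p')) n
      ≈⟨ +-congˡ (summands-at-multiples-of-p≈V-gcoef k g n j) ⟩
    sumUpTo (λ t → sumUpTo (λ i → F j (t ℕ.* p ℕ.+ i)) p') n + V p (gcoef k g n) j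
      ∎)
    where
    open ≈-Reasoning
    p = suc p'
    F : ℤ → ℕ → Carrier
    F = summand k g (n ℕ.* p)
    off-multiples : ∀ j → p ℕ.^ (k ∸ 1) ∣ᴿ sumUpTo (λ t → sumUpTo (λ i → F j (t ℕ.* p ℕ.+ i)) p') n
    off-multiples j = ∣ᴿ-sumUpTo n λ t _ → ∣ᴿ-sumUpTo p' λ i i<p' →
      p∤r⇒p^[k-1]∣ᴿsummand k g n j pp (≡.subst (p ∤_) (ℕP.+-suc (t ℕ.* p) i) (p∤t*p+r t (s<s i<p')))

open import Data.Nat using (_*_; _^_; _≤_)
open import Data.Nat.Primality using (prime⇒nonZero)

lemma5p4 : ∀ {c ℓ} (R : CommutativeRing c ℓ) (k : ℕ) → 2 ∣ k → 1 ≤ k →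
    (p : ℕ) (pp : Prime p) (g : ℤ → CommutativeRing.Carrier R) →
    Laurent.IsLaurent R g →
    (n : ℕ) → 1 ≤ n →
    Laurent._≡_[mod_] R
      (Laurent.gcoef R k g (n * p))
      (Laurent.V R p {{prime⇒nonZero pp}} (Laurent.gcoef R k g n))
      (p ^ (k ∸ 1))
lemma5p4 R k _ _ zero    ()
lemma5p4 R k _ _ (suc _) pp g _ n _ = gcoef[n*p]≡V[gcoef[n]] R k g n pp
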